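{- Let $a,b\in\mathbb{Z}$. \begin{enumerate} \item The power series $g(t)=(t-1)(t-\mathbb{L}^{ -a})\sum_{n\ge0}[\mathbb{P}^{an+b}]t^n\in\mathcal{M}[[t]]$ is a polynomial, and $g(\mathbb{L}^{ -a})=\mathbb{L}^{b-a}\bigl(1-[\mathbb{P}^{ -a}]\bigr)$. \item The series $\sum_{n<0}[\mathbb{P}^{an+b}]t^n$ is a rational function of $t^{ -1}$, and as elements of $\mathcal{M}(t^{ -1})=\mathcal{M}(t)$, \[\sum_{n<0}[\mathbb{P}^{an+b}]t^n+\sum_{n\ge0}[\mathbb{P}^{an+b}]t^n=0.\] \end{enumerate}
   Context: $k$ is a field, $K$ the Grothendieck ring of quasi-projective $k$-varieties, $\widetilde{K}$ its quotient by the ideal generated by $[X]-[Y]$ for all radicial surjective morphisms $X\to Y$, $\mathbb{L}$ the class of $\mathbb{A}^1$ in $\widetilde{K}$, and $\mathcal{M}=\widetilde{K}[\mathbb{L}^{ -1}]$. For $m\ge0$, $[\mathbb{P}^m]=1+\mathbb{L}+\dots+\mathbb{L}^m$; for all $m\in\mathbb{Z}$, $[\mathbb{P}^m]\in\mathcal{M}$ is defined by extending via the recursion $[\mathbb{P}^{m+1}]-\mathbb{L}[\mathbb{P}^m]=1$. -}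

module Defs where

open import Level using (_⊔_)
open import Algebra.Bundles using (CommutativeRing)
open import Data.Nat using (ℕ; zero; suc)
open import Data.Integer using (ℤ; +_; -[1+_])
import Data.Integer
open import Data.List using (List; []; _∷_)

-- All notions are relative to a commutative ring R (standing in for
-- M = K~[L^{-1}]) together with an element L and a chosen inverse Linv.
module Motivic {c ℓ} (R : CommutativeRing c ℓ) (L Linv : CommutativeRing.Carrier R) where
  open CommutativeRing R hiding (zero)

  pow : Carrier → ℕ → Carrier
  pow x zero = 1#
  pow x (suc n) = x * pow x n

  Lz : ℤ → Carrier
  Lz (+ n) = pow L n
  Lz -[1+ n ] = pow Linv (suc n)

  Pnat : ℕ → Carrier
  Pnat zero = 1#
  Pnat (suc m) = Pnat m + pow L (suc m)

  -- [P^m] for all m ∈ ℤ, extended by [P^{m+1}] - L [P^m] = 1,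
  -- i.e. [P^m] = L^{-1} ([P^{m+1}] - 1) for m < 0.
  -- Pneg n = [P^{-(n+1)}]
  Pneg : ℕ → Carrier
  Pneg zero = Linv * (Pnat zero - 1#)
  Pneg (suc n) = Linv * (Pneg n - 1#)

  P : ℤ → Carrier
  P (+ m) = Pnat m
  P -[1+ n ] = Pneg n

  Series : Set c
  Series = ℕ → Carrier

  _≈ˢ_ : Series → Series → Set ℓ
  f ≈ˢ g = ∀ n → f n ≈ g n

  -- polynomials: ascending coefficient lists
  Poly : Set c
  Poly = List Carrier

  toSeries : Poly → Series
  toSeries [] n = 0#
  toSeries (x ∷ p) zero = x
  toSeries (x ∷ p) (suc n) = toSeries p n

  shift : Series → Series
  shift f zero = 0#
  shift f (suc n) = f n

  _·ˢ_ : Poly → Series → Series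
  ([] ·ˢ f) n = 0#
  ((x ∷ p) ·ˢ f) n = x * f n + shift (p ·ˢ f) n

  eval : Poly → Carrier → Carrier
  eval [] x = 0#
  eval (y ∷ p) x = y + x * eval p x

  coeffℤ : Poly → ℤ → Carrier
  coeffℤ p (+ n) = toSeries p n
  coeffℤ p -[1+ n ] = 0#

  -- coefficient of t^k in the Laurent polynomial p(t) * s(t^{-1})
  laurentCoeff : Poly → Poly → ℤ → Carrier
  laurentCoeff p [] k = 0#
  laurentCoeff p (y ∷ s) k = coeffℤ p k * y + laurentCoeff p s (Data.Integer._+_ k (+ 1))

  posSeries : ℤ → ℤ → Series
  posSeries a b n = P (Data.Integer._+_ (Data.Integer._*_ a (+ n)) b)

  -- Σ_{n<0} [P^{an+b}] t^n, written as a power series in u = t^{-1}: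
  -- coefficient of u^m is [P^{-am+b}] for m ≥ 1, and 0 for m = 0.
  negSeries : ℤ → ℤ → Series
  negSeries a b zero = 0#
  negSeries a b (suc m) = P (Data.Integer._+_ (Data.Integer._*_ a -[1+ m ]) b)

module Submission where

-- Lemma 4.6.  Put x n = [P^{an+b}] (n ∈ ℤ) and c = L^a.  Everything rests on
-- the shift law [P^{m+k}] = L^k ([P^m] - 1) + [P^k] (m, k ∈ ℤ): both sides
-- satisfy u(k+1) = L u(k) + 1 and agree at k = 0, and since L is a unit such
-- a recursion has a unique solution on ℤ.  The shift law gives the differences
-- x (n+1) - x n = L^{an+b} ([P^a] - 1), a geometric progression of ratio c
-- (ratio c⁻¹ read backwards), so x obeys the three-term recurrence of
-- (1 - t)(1 - c t) and of its reciprocal (t - 1)(t - c⁻¹); multiplying a series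
-- obeying such a recurrence by the quadratic leaves a linear polynomial.  This
-- is (1).  For (2), the series over n < 0 is u = t⁻¹ times a series obeying the
-- mirrored recurrence, with numerator -u² p(u⁻¹) over u² q(u⁻¹), so the sum of
-- the two rational functions vanishes.

open import Defs
open import Algebra.Bundles using (CommutativeRing; Ring)
open import Algebra.Solver.Ring.AlmostCommutativeRing as ACR using (_-Raw-AlmostCommutative⟶_)
open import Data.Integer using (ℤ; +_; -[1+_]; _⊖_)
import Data.Integer as Z
open import Data.List using ([]; _∷_)
open import Data.Maybe using (Maybe; nothing; just)
open import Data.Nat as ℕ using (zero; suc)
import Data.Nat.Properties as ℕP
open import Data.Product using (Σ; _×_; _,_)
import Data.Integer.Properties as ℤP
import Data.Integer.Tactic.RingSolver as ℤSolver
open import Relation.Binary.PropositionalEquality as Eq using (_≡_)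
open import Relation.Nullary using (yes; no)

module IntegerCoefficients {c ℓ} (R : CommutativeRing c ℓ) where
  open CommutativeRing R
  open import Algebra.Properties.Semiring.Mult.TCOptimised semiring
    using (1+×; ×-homo-+; ×1-homo-*) renaming (_×_ to _⊗_)
  open import Algebra.Properties.RingWithoutOne (Ring.ringWithoutOne ring)
    using (-‿distribˡ-*; -‿distribʳ-*; -‿involutive; -‿+-comm; -0#≈0#)
  open import Relation.Binary.Reasoning.Setoid setoid

  ι : ℤ → Carrier
  ι (+ n) = n ⊗ 1#
  ι -[1+ n ] = - (suc n ⊗ 1#)

  cancel-one : ∀ a b → a - b ≈ (1# + a) - (1# + b)
  cancel-one a b = sym (begin
    (1# + a) + - (1# + b)  ≈⟨ +-congˡ (sym (-‿+-comm 1# b)) ⟩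
    (1# + a) + (- 1# + - b) ≈⟨ +-congʳ (+-comm 1# a) ⟩
    (a + 1#) + (- 1# + - b) ≈⟨ +-assoc a 1# _ ⟩
    a + (1# + (- 1# + - b)) ≈⟨ +-congˡ (sym (+-assoc 1# (- 1#) (- b))) ⟩
    a + ((1# - 1#) + - b)   ≈⟨ +-congˡ (+-congʳ (-‿inverseʳ 1#)) ⟩
    a + (0# + - b)          ≈⟨ +-congˡ (+-identityˡ _) ⟩
    a - b                   ∎)

  ι-⊖ : ∀ m n → ι (m ⊖ n) ≈ m ⊗ 1# - n ⊗ 1#
  ι-⊖ m zero = sym (trans (+-congˡ -0#≈0#) (+-identityʳ _))
  ι-⊖ zero (suc n) = sym (+-identityˡ _)
  ι-⊖ (suc m) (suc n) = begin
    ι (suc m ⊖ suc n)                ≡⟨ Eq.cong ι (ℤP.[1+m]⊖[1+n]≡m⊖n m n) ⟩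
    ι (m ⊖ n)                        ≈⟨ ι-⊖ m n ⟩
    m ⊗ 1# - n ⊗ 1#                  ≈⟨ cancel-one _ _ ⟩
    (1# + m ⊗ 1#) - (1# + n ⊗ 1#)    ≈⟨ sym (+-cong (1+× m 1#) (-‿cong (1+× n 1#))) ⟩
    suc m ⊗ 1# - suc n ⊗ 1#          ∎

  ι-+ : ∀ i j → ι (i Z.+ j) ≈ ι i + ι j
  ι-+ (+ m) (+ n) = ×-homo-+ 1# m n
  ι-+ (+ m) -[1+ n ] = ι-⊖ m (suc n)
  ι-+ -[1+ m ] (+ n) = trans (ι-⊖ n (suc m)) (+-comm _ _)
  ι-+ -[1+ m ] -[1+ n ] = begin
    - (suc (suc (m ℕ.+ n)) ⊗ 1#)      ≡⟨ Eq.cong (λ k → - (suc k ⊗ 1#)) (Eq.sym (ℕP.+-suc m n)) ⟩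
    - ((suc m ℕ.+ suc n) ⊗ 1#)        ≈⟨ -‿cong (×-homo-+ 1# (suc m) (suc n)) ⟩
    - (suc m ⊗ 1# + suc n ⊗ 1#)       ≈⟨ sym (-‿+-comm _ _) ⟩
    - (suc m ⊗ 1#) + - (suc n ⊗ 1#)   ∎

  ι-* : ∀ i j → ι (i Z.* j) ≈ ι i * ι j
  ι-* (+ m) (+ n) = trans (reflexive (Eq.cong ι (ℤP.+◃n≡+n (m ℕ.* n)))) (×1-homo-* m n)
  ι-* (+ zero) -[1+ n ] = sym (zeroˡ _)
  ι-* (+ suc m) -[1+ n ] = trans (-‿cong (×1-homo-* (suc m) (suc n))) (-‿distribʳ-* _ _)
  ι-* -[1+ m ] (+ zero) = trans (reflexive (Eq.cong ι (ℤP.*-zeroʳ -[1+ m ]))) (sym (zeroʳ _))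
  ι-* -[1+ m ] (+ suc n) = trans (-‿cong (×1-homo-* (suc m) (suc n))) (-‿distribˡ-* _ _)
  ι-* -[1+ m ] -[1+ n ] = begin
    ι (-[1+ m ] Z.* -[1+ n ])           ≡⟨ Eq.cong ι (ℤP.+◃n≡+n (suc m ℕ.* suc n)) ⟩
    (suc m ℕ.* suc n) ⊗ 1#              ≈⟨ ×1-homo-* (suc m) (suc n) ⟩
    (suc m ⊗ 1#) * (suc n ⊗ 1#)         ≈⟨ sym (-‿involutive _) ⟩
    - - ((suc m ⊗ 1#) * (suc n ⊗ 1#))   ≈⟨ -‿cong (-‿distribʳ-* _ _) ⟩
    - ((suc m ⊗ 1#) * ι -[1+ n ])       ≈⟨ -‿distribˡ-* _ _ ⟩
    ι -[1+ m ] * ι -[1+ n ]             ∎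

  ι-neg : ∀ i → ι (Z.- i) ≈ - ι i
  ι-neg (+ zero) = sym -0#≈0#
  ι-neg (+ suc n) = refl
  ι-neg -[1+ n ] = sym (-‿involutive _)

  ι-homomorphism : Z.+-*-rawRing -Raw-AlmostCommutative⟶ ACR.fromCommutativeRing R
  ι-homomorphism = record
    { ⟦_⟧ = ι ; +-homo = ι-+ ; *-homo = ι-* ; -‿homo = ι-neg ; 0-homo = refl ; 1-homo = refl }

  -- equal coefficients give equal images (the solver only needs soundness)
  ι-≟ : ∀ i j → Maybe (ι i ≈ ι j)
  ι-≟ i j with i Z.≟ j
  ... | yes Eq.refl = just refl
  ... | no _ = nothing

  open import Algebra.Solver.Ring Z.+-*-rawRing (ACR.fromCommutativeRing R) ι-homomorphism ι-≟ public

  :0 :1 : ∀ {n} → Polynomial n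
  :0 = con (+ 0)
  :1 = con (+ 1)

module CommutativeRingLemmas {c ℓ} (R : CommutativeRing c ℓ) where
  open CommutativeRing R
  open IntegerCoefficients R using (solve; _:=_; _:+_; _:*_; _:-_; :1)
  open import Relation.Binary.Reasoning.Setoid setoid

  modulo : ∀ {X Y l r} k → l ≈ r → X ≈ Y + k * (l - r) → X ≈ Y
  modulo {X} {Y} {l} {r} k l≈r X≈ = begin
    X               ≈⟨ X≈ ⟩
    Y + k * (l - r) ≈⟨ +-congˡ (*-congˡ (+-congʳ l≈r)) ⟩
    Y + k * (r - r) ≈⟨ solve 3 (λ Y k r → Y :+ k :* (r :- r) := Y) refl Y k r ⟩
    Y               ∎

  cancel-unit : ∀ {u w} → u * w ≈ 1# → ∀ y → w * (u * y) ≈ y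
  cancel-unit {u} {w} uw≈1 y = modulo y uw≈1
    (solve 3 (λ u w y → w :* (u :* y) := y :+ y :* (u :* w :- :1)) refl u w y)

ℤ-induction : ∀ {p} (Q : ℤ → Set p) → Q (+ 0)
            → (∀ k → Q k → Q (Z.suc k)) → (∀ k → Q (Z.suc k) → Q k) → ∀ k → Q k
ℤ-induction Q base up down (+ zero) = base
ℤ-induction Q base up down (+ suc n) = up (+ n) (ℤ-induction Q base up down (+ n))
ℤ-induction Q base up down -[1+ zero ] = down -[1+ zero ] base
ℤ-induction Q base up down -[1+ suc n ] = down -[1+ suc n ] (ℤ-induction Q base up down -[1+ n ])

-- Index arithmetic in ℤ (Z.suc k unfolds to + 1 Z.+ k).
+-suc : ∀ m k → m Z.+ (+ 1 Z.+ k) ≡ + 1 Z.+ (m Z.+ k)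
+-suc = ℤSolver.solve-∀

*-suc-+ : ∀ a n b → a Z.* (+ 1 Z.+ n) Z.+ b ≡ a Z.+ (a Z.* n Z.+ b)
*-suc-+ = ℤSolver.solve-∀

module SeriesAlgebra {c ℓ} (R : CommutativeRing c ℓ) (L Linv : CommutativeRing.Carrier R) where
  open CommutativeRing R hiding (zero)
  open Motivic R L Linv
  open IntegerCoefficients R using (solve; _:=_; _:+_; _:*_; :-_; :0)
  open import Relation.Binary.Reasoning.Setoid setoid

  shift-zero : ∀ f n → shift ([] ·ˢ f) n ≈ 0#
  shift-zero f zero = refl
  shift-zero f (suc n) = refl

  linear-coeff : ∀ γ δ f n → ((γ ∷ δ ∷ []) ·ˢ f) (suc n) ≈ γ * f (suc n) + δ * f n
  linear-coeff γ δ f n = +-congˡ (trans (+-congˡ (shift-zero f n)) (+-identityʳ _))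

  quadratic-coeff : ∀ q₀ q₁ q₂ f n →
    ((q₀ ∷ q₁ ∷ q₂ ∷ []) ·ˢ f) (suc (suc n)) ≈ q₀ * f (suc (suc n)) + (q₁ * f (suc n) + q₂ * f n)
  quadratic-coeff q₀ q₁ q₂ f n = +-congˡ (linear-coeff q₁ q₂ f n)

  linear-product : ∀ α β γ δ f →
    ((α ∷ β ∷ []) ·ˢ ((γ ∷ δ ∷ []) ·ˢ f)) ≈ˢ ((α * γ ∷ α * δ + β * γ ∷ β * δ ∷ []) ·ˢ f)
  linear-product α β γ δ f zero =
    solve 3 (λ α γ f₀ → α :* (γ :* f₀ :+ :0) :+ :0 := α :* γ :* f₀ :+ :0)
      refl α γ (f 0)
  linear-product α β γ δ f (suc zero) = begin
    ((α ∷ β ∷ []) ·ˢ H) 1                        ≈⟨ linear-coeff α β H 0 ⟩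
    α * H 1 + β * H 0                            ≈⟨ +-congʳ (*-congˡ (linear-coeff γ δ f 0)) ⟩
    α * (γ * f 1 + δ * f 0) + β * (γ * f 0 + 0#) ≈⟨ solve 6 (λ α β γ δ f₀ f₁ →
      α :* (γ :* f₁ :+ δ :* f₀) :+ β :* (γ :* f₀ :+ :0)
        := α :* γ :* f₁ :+ ((α :* δ :+ β :* γ) :* f₀ :+ :0)) refl α β γ δ (f 0) (f 1) ⟩
    ((α * γ ∷ α * δ + β * γ ∷ β * δ ∷ []) ·ˢ f) 1 ∎
    where H = (γ ∷ δ ∷ []) ·ˢ f
  linear-product α β γ δ f (suc (suc n)) = begin
    ((α ∷ β ∷ []) ·ˢ H) (2 ℕ.+ n)                             ≈⟨ linear-coeff α β H (suc n) ⟩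
    α * H (2 ℕ.+ n) + β * H (suc n)                           ≈⟨ +-cong (*-congˡ (linear-coeff γ δ f (suc n)))
                                                                          (*-congˡ (linear-coeff γ δ f n)) ⟩
    α * (γ * f (2 ℕ.+ n) + δ * f (suc n)) + β * (γ * f (suc n) + δ * f n)
      ≈⟨ solve 7 (λ α β γ δ f₀ f₁ f₂ →
           α :* (γ :* f₂ :+ δ :* f₁) :+ β :* (γ :* f₁ :+ δ :* f₀)
             := α :* γ :* f₂ :+ ((α :* δ :+ β :* γ) :* f₁ :+ β :* δ :* f₀))
         refl α β γ δ (f n) (f (suc n)) (f (2 ℕ.+ n)) ⟩
    α * γ * f (2 ℕ.+ n) + ((α * δ + β * γ) * f (suc n) + β * δ * f n)
      ≈⟨ sym (quadratic-coeff (α * γ) (α * δ + β * γ) (β * δ) f n) ⟩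
    ((α * γ ∷ α * δ + β * γ ∷ β * δ ∷ []) ·ˢ f) (2 ℕ.+ n) ∎
    where H = (γ ∷ δ ∷ []) ·ˢ f

  quadratic-annihilates : ∀ q₀ q₁ q₂ f r₀ r₁
    → (∀ n → q₀ * f (suc (suc n)) + (q₁ * f (suc n) + q₂ * f n) ≈ 0#)
    → q₀ * f 0 ≈ r₀ → q₀ * f 1 + q₁ * f 0 ≈ r₁
    → ((q₀ ∷ q₁ ∷ q₂ ∷ []) ·ˢ f) ≈ˢ toSeries (r₀ ∷ r₁ ∷ [])
  quadratic-annihilates q₀ q₁ q₂ f r₀ r₁ recurrence e₀ e₁ zero = trans (+-identityʳ _) e₀
  quadratic-annihilates q₀ q₁ q₂ f r₀ r₁ recurrence e₀ e₁ (suc zero) =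
    trans (+-congˡ (+-identityʳ _)) e₁
  quadratic-annihilates q₀ q₁ q₂ f r₀ r₁ recurrence e₀ e₁ (suc (suc n)) =
    trans (quadratic-coeff q₀ q₁ q₂ f n) (recurrence n)

  ·ˢ-shift : ∀ p f g → f ≈ˢ shift g → (p ·ˢ f) ≈ˢ shift (p ·ˢ g)
  ·ˢ-shift [] f g f≈tg zero = refl
  ·ˢ-shift [] f g f≈tg (suc n) = refl
  ·ˢ-shift (y ∷ p) f g f≈tg zero = trans (+-identityʳ _) (trans (*-congˡ (f≈tg 0)) (zeroʳ y))
  ·ˢ-shift (y ∷ p) f g f≈tg (suc n) = +-cong (*-congˡ (f≈tg (suc n))) (·ˢ-shift p f g f≈tg n)

  shift-rational : ∀ p f g r → f ≈ˢ shift g → (p ·ˢ g) ≈ˢ toSeries r → (p ·ˢ f) ≈ˢ toSeries (0# ∷ r)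
  shift-rational p f g r f≈tg pg≈r zero = ·ˢ-shift p f g f≈tg zero
  shift-rational p f g r f≈tg pg≈r (suc n) = trans (·ˢ-shift p f g f≈tg (suc n)) (pg≈r n)

  -- For p of degree ≤ 1 and q of degree ≤ 2, with s(u) = u² q(u⁻¹) and
  -- r(u) = -u² p(u⁻¹):  p(t) s(t⁻¹) + q(t) r(t⁻¹) = t⁻² (p q - q p) = 0,
  -- checked coefficientwise (for k ∉ [-2, 1] every term is zero).
  reciprocal-sum-vanishes : ∀ p₀ p₁ q₀ q₁ q₂ k →
    laurentCoeff (p₀ ∷ p₁ ∷ []) (q₂ ∷ q₁ ∷ q₀ ∷ []) k
      + laurentCoeff (q₀ ∷ q₁ ∷ q₂ ∷ []) (0# ∷ - p₁ ∷ - p₀ ∷ []) k ≈ 0#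
  reciprocal-sum-vanishes p₀ p₁ q₀ q₁ q₂ (+ zero) = solve 5 (λ p₀ p₁ q₀ q₁ q₂ →
    (p₀ :* q₂ :+ (p₁ :* q₁ :+ (:0 :* q₀ :+ :0))) :+ (q₀ :* :0 :+ (q₁ :* :- p₁ :+ (q₂ :* :- p₀ :+ :0))) := :0)
    refl p₀ p₁ q₀ q₁ q₂
  reciprocal-sum-vanishes p₀ p₁ q₀ q₁ q₂ (+ suc zero) = solve 5 (λ p₀ p₁ q₀ q₁ q₂ →
    (p₁ :* q₂ :+ (:0 :* q₁ :+ (:0 :* q₀ :+ :0))) :+ (q₁ :* :0 :+ (q₂ :* :- p₁ :+ (:0 :* :- p₀ :+ :0))) := :0)
    refl p₀ p₁ q₀ q₁ q₂
  reciprocal-sum-vanishes p₀ p₁ q₀ q₁ q₂ (+ suc (suc zero)) = solve 5 (λ p₀ p₁ q₀ q₁ q₂ →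
    (:0 :* q₂ :+ (:0 :* q₁ :+ (:0 :* q₀ :+ :0))) :+ (q₂ :* :0 :+ (:0 :* :- p₁ :+ (:0 :* :- p₀ :+ :0))) := :0)
    refl p₀ p₁ q₀ q₁ q₂
  reciprocal-sum-vanishes p₀ p₁ q₀ q₁ q₂ (+ suc (suc (suc n))) = solve 5 (λ p₀ p₁ q₀ q₁ q₂ →
    (:0 :* q₂ :+ (:0 :* q₁ :+ (:0 :* q₀ :+ :0))) :+ (:0 :* :0 :+ (:0 :* :- p₁ :+ (:0 :* :- p₀ :+ :0))) := :0)
    refl p₀ p₁ q₀ q₁ q₂
  reciprocal-sum-vanishes p₀ p₁ q₀ q₁ q₂ -[1+ zero ] = solve 5 (λ p₀ p₁ q₀ q₁ q₂ →
    (:0 :* q₂ :+ (p₀ :* q₁ :+ (p₁ :* q₀ :+ :0))) :+ (:0 :* :0 :+ (q₀ :* :- p₁ :+ (q₁ :* :- p₀ :+ :0))) := :0)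
    refl p₀ p₁ q₀ q₁ q₂
  reciprocal-sum-vanishes p₀ p₁ q₀ q₁ q₂ -[1+ suc zero ] = solve 5 (λ p₀ p₁ q₀ q₁ q₂ →
    (:0 :* q₂ :+ (:0 :* q₁ :+ (p₀ :* q₀ :+ :0))) :+ (:0 :* :0 :+ (:0 :* :- p₁ :+ (q₀ :* :- p₀ :+ :0))) := :0)
    refl p₀ p₁ q₀ q₁ q₂
  reciprocal-sum-vanishes p₀ p₁ q₀ q₁ q₂ -[1+ suc (suc n) ] = solve 5 (λ p₀ p₁ q₀ q₁ q₂ →
    (:0 :* q₂ :+ (:0 :* q₁ :+ (:0 :* q₀ :+ :0))) :+ (:0 :* :0 :+ (:0 :* :- p₁ :+ (:0 :* :- p₀ :+ :0))) := :0)
    refl p₀ p₁ q₀ q₁ q₂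

module MotivicClasses {c ℓ} (R : CommutativeRing c ℓ) (L Linv : CommutativeRing.Carrier R)
       (L*Linv≈1 : CommutativeRing._≈_ R (CommutativeRing._*_ R L Linv) (CommutativeRing.1# R)) where
  open CommutativeRing R hiding (zero)
  open Motivic R L Linv
  open IntegerCoefficients R using (solve; _:=_; _:+_; _:*_; _:-_; :-_; :1)
  open CommutativeRingLemmas R
  open import Algebra.Properties.RingWithoutOne (Ring.ringWithoutOne ring) using (+-cancelʳ)
  open import Relation.Binary.Reasoning.Setoid setoid

  Linv*L≈1 : Linv * L ≈ 1#
  Linv*L≈1 = trans (*-comm Linv L) L*Linv≈1

  L-cancel : ∀ {u v} → L * u ≈ L * v → u ≈ v
  L-cancel {u} {v} Lu≈Lv = begin
    u              ≈⟨ sym (cancel-unit L*Linv≈1 u) ⟩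
    Linv * (L * u) ≈⟨ *-congˡ Lu≈Lv ⟩
    Linv * (L * v) ≈⟨ cancel-unit L*Linv≈1 v ⟩
    v              ∎

  -- Since L is a unit, a solution of u(k+1) = L u(k) + μ on ℤ is determined
  -- by its value at 0.
  recursion-unique : ∀ μ (u v : ℤ → Carrier) → u (+ 0) ≈ v (+ 0)
    → (∀ k → u (Z.suc k) ≈ L * u k + μ) → (∀ k → v (Z.suc k) ≈ L * v k + μ)
    → ∀ k → u k ≈ v k
  recursion-unique μ u v base u-step v-step = ℤ-induction (λ k → u k ≈ v k) base up down
    where
    up : ∀ k → u k ≈ v k → u (Z.suc k) ≈ v (Z.suc k)
    up k uk≈vk = begin
      u (Z.suc k) ≈⟨ u-step k ⟩
      L * u k + μ ≈⟨ +-congʳ (*-congˡ uk≈vk) ⟩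
      L * v k + μ ≈⟨ sym (v-step k) ⟩
      v (Z.suc k) ∎
    down : ∀ k → u (Z.suc k) ≈ v (Z.suc k) → u k ≈ v k
    down k usk≈vsk = L-cancel (+-cancelʳ μ _ _ (begin
      L * u k + μ ≈⟨ sym (u-step k) ⟩
      u (Z.suc k) ≈⟨ usk≈vsk ⟩
      v (Z.suc k) ≈⟨ v-step k ⟩
      L * v k + μ ∎))

  Lz-suc : ∀ k → Lz (Z.suc k) ≈ L * Lz k
  Lz-suc (+ n) = refl
  Lz-suc -[1+ zero ] = sym (cancel-unit Linv*L≈1 1#)
  Lz-suc -[1+ suc n ] = sym (cancel-unit Linv*L≈1 _)

  Lz-+ : ∀ k j → Lz (k Z.+ j) ≈ Lz k * Lz j
  Lz-+ k j = recursion-unique 0# (λ k → Lz (k Z.+ j)) (λ k → Lz k * Lz j) base stepˡ stepʳ k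
    where
    base : Lz (+ 0 Z.+ j) ≈ 1# * Lz j
    base = trans (reflexive (Eq.cong Lz (ℤP.+-identityˡ j))) (sym (*-identityˡ _))
    stepˡ : ∀ k → Lz (Z.suc k Z.+ j) ≈ L * Lz (k Z.+ j) + 0#
    stepˡ k = begin
      Lz (Z.suc k Z.+ j)      ≡⟨ Eq.cong Lz (ℤP.+-assoc (+ 1) k j) ⟩
      Lz (Z.suc (k Z.+ j))    ≈⟨ Lz-suc (k Z.+ j) ⟩
      L * Lz (k Z.+ j)        ≈⟨ sym (+-identityʳ _) ⟩
      L * Lz (k Z.+ j) + 0#   ∎
    stepʳ : ∀ k → Lz (Z.suc k) * Lz j ≈ L * (Lz k * Lz j) + 0#
    stepʳ k = begin
      Lz (Z.suc k) * Lz j     ≈⟨ *-congʳ (Lz-suc k) ⟩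
      L * Lz k * Lz j         ≈⟨ *-assoc L _ _ ⟩
      L * (Lz k * Lz j)       ≈⟨ sym (+-identityʳ _) ⟩
      L * (Lz k * Lz j) + 0#  ∎

  Lz-inverse : ∀ k → Lz k * Lz (Z.- k) ≈ 1#
  Lz-inverse k = trans (sym (Lz-+ k (Z.- k))) (reflexive (Eq.cong Lz (ℤP.+-inverseʳ k)))

  Pnat-suc : ∀ n → Pnat (suc n) ≈ L * Pnat n + 1#
  Pnat-suc zero = +-comm 1# (L * 1#)
  Pnat-suc (suc n) = begin
    Pnat (suc n) + L * pow L (suc n)          ≈⟨ +-congʳ (Pnat-suc n) ⟩
    (L * Pnat n + 1#) + L * pow L (suc n)     ≈⟨ solve 3 (λ l x y → (l :* x :+ :1) :+ l :* y
                                                    := l :* (x :+ y) :+ :1) refl L (Pnat n) (pow L (suc n)) ⟩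
    L * (Pnat n + pow L (suc n)) + 1#         ∎

  step-back : ∀ y → L * (Linv * (y - 1#)) + 1# ≈ y
  step-back y = trans (+-congʳ (cancel-unit Linv*L≈1 _))
    (solve 1 (λ y → y :- :1 :+ :1 := y) refl y)

  P-suc : ∀ m → P (Z.suc m) ≈ L * P m + 1#
  P-suc (+ n) = Pnat-suc n
  P-suc -[1+ zero ] = sym (step-back 1#)
  P-suc -[1+ suc n ] = sym (step-back (Pneg n))

  -- The shift law [P^{m+k}] = L^k ([P^m] - 1) + [P^k]: both sides satisfy the
  -- recursion of P-suc in k and agree at k = 0.
  P-shift : ∀ m k → P (m Z.+ k) ≈ Lz k * (P m - 1#) + P k
  P-shift m = recursion-unique 1# (λ k → P (m Z.+ k)) (λ k → Lz k * (P m - 1#) + P k) base stepˡ stepʳ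
    where
    base : P (m Z.+ + 0) ≈ 1# * (P m - 1#) + 1#
    base = trans (reflexive (Eq.cong P (ℤP.+-identityʳ m)))
      (solve 1 (λ x → x := :1 :* (x :- :1) :+ :1) refl (P m))
    stepˡ : ∀ k → P (m Z.+ Z.suc k) ≈ L * P (m Z.+ k) + 1#
    stepˡ k = trans (reflexive (Eq.cong P (+-suc m k))) (P-suc (m Z.+ k))
    stepʳ : ∀ k → Lz (Z.suc k) * (P m - 1#) + P (Z.suc k) ≈ L * (Lz k * (P m - 1#) + P k) + 1#
    stepʳ k = begin
      Lz (Z.suc k) * (P m - 1#) + P (Z.suc k)   ≈⟨ +-cong (*-congʳ (Lz-suc k)) (P-suc k) ⟩
      L * Lz k * (P m - 1#) + (L * P k + 1#)    ≈⟨ solve 4 (λ l u x y →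
        l :* u :* (x :- :1) :+ (l :* y :+ :1) := l :* (u :* (x :- :1) :+ y) :+ :1)
        refl L (Lz k) (P m) (P k) ⟩
      L * (Lz k * (P m - 1#) + P k) + 1#        ∎

  P-reflection : ∀ a → P a - 1# ≈ Lz a * (1# - P (Z.- a))
  P-reflection a = modulo (- 1#) one≈ (solve 3 (λ u x y →
      x :- :1 := u :* (:1 :- y) :+ :- :1 :* (:1 :- (u :* (y :- :1) :+ x)))
      refl (Lz a) (P a) (P (Z.- a)))
    where
    one≈ : 1# ≈ Lz a * (P (Z.- a) - 1#) + P a
    one≈ = trans (reflexive (Eq.cong P (Eq.sym (ℤP.+-inverseˡ a)))) (P-shift (Z.- a) a)

module Progression {c ℓ} (R : CommutativeRing c ℓ) (L Linv : CommutativeRing.Carrier R)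
       (L*Linv≈1 : CommutativeRing._≈_ R (CommutativeRing._*_ R L Linv) (CommutativeRing.1# R))
       (a b : ℤ) where
  open CommutativeRing R hiding (zero)
  open Motivic R L Linv
  open IntegerCoefficients R using (solve; _:=_; _:+_; _:*_; _:-_; :-_; :0; :1)
  open CommutativeRingLemmas R
  open SeriesAlgebra R L Linv
  open MotivicClasses R L Linv L*Linv≈1
  open import Relation.Binary.Reasoning.Setoid setoid

  c⁺ c⁻ : Carrier
  c⁺ = Lz a
  c⁻ = Lz (Z.- a)

  x : ℤ → Carrier
  x n = P (a Z.* n Z.+ b)

  Δ : ℤ → Carrier
  Δ n = x (Z.suc n) - x n

  Δ-closed : ∀ n → Δ n ≈ Lz (a Z.* n Z.+ b) * (P a - 1#)
  Δ-closed n = begin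
    x (Z.suc n) - x n                   ≡⟨ Eq.cong (λ i → P i - x n) (*-suc-+ a n b) ⟩
    P (a Z.+ (a Z.* n Z.+ b)) - x n     ≈⟨ +-congʳ (P-shift a (a Z.* n Z.+ b)) ⟩
    (u * (P a - 1#) + x n) - x n        ≈⟨ solve 2 (λ d y → d :+ y :- y := d) refl (u * (P a - 1#)) (x n) ⟩
    u * (P a - 1#)                      ∎
    where u = Lz (a Z.* n Z.+ b)

  ratio : ∀ n → Δ (Z.suc n) ≈ c⁺ * Δ n
  ratio n = begin
    Δ (Z.suc n)                                   ≈⟨ Δ-closed (Z.suc n) ⟩
    Lz (a Z.* Z.suc n Z.+ b) * (P a - 1#)         ≡⟨ Eq.cong (λ i → Lz i * (P a - 1#)) (*-suc-+ a n b) ⟩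
    Lz (a Z.+ (a Z.* n Z.+ b)) * (P a - 1#)       ≈⟨ *-congʳ (Lz-+ a _) ⟩
    c⁺ * Lz (a Z.* n Z.+ b) * (P a - 1#)          ≈⟨ *-assoc c⁺ _ _ ⟩
    c⁺ * (Lz (a Z.* n Z.+ b) * (P a - 1#))        ≈⟨ *-congˡ (sym (Δ-closed n)) ⟩
    c⁺ * Δ n                                      ∎

  ratio⁻ : ∀ n → Δ n ≈ c⁻ * Δ (Z.suc n)
  ratio⁻ n = sym (trans (*-congˡ (ratio n)) (cancel-unit (Lz-inverse a) (Δ n)))

  F : Series
  F = posSeries a b

  g : Poly
  g = c⁻ * x (+ 0) ∷ c⁻ * x (+ 1) - (1# + c⁻) * x (+ 0) ∷ []

  g-numerator : ((- 1# ∷ 1# ∷ []) ·ˢ ((- c⁻ ∷ 1# ∷ []) ·ˢ F)) ≈ˢ toSeries g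
  g-numerator n = trans (linear-product (- 1#) 1# (- c⁻) 1# F n)
    (quadratic-annihilates _ _ _ F _ _ recurrence
      (solve 2 (λ v y → :- :1 :* :- v :* y := v :* y) refl c⁻ (F 0))
      (solve 3 (λ v y₀ y₁ → :- :1 :* :- v :* y₁ :+ (:- :1 :* :1 :+ :1 :* :- v) :* y₀
                            := v :* y₁ :- (:1 :+ v) :* y₀) refl c⁻ (F 0) (F 1)) n)
    where
    recurrence : ∀ n → - 1# * - c⁻ * F (2 ℕ.+ n) + ((- 1# * 1# + 1# * - c⁻) * F (suc n) + 1# * 1# * F n) ≈ 0#
    recurrence n = modulo (- 1#) (ratio⁻ (+ n)) (solve 4 (λ v y₀ y₁ y₂ →
      :- :1 :* :- v :* y₂ :+ ((:- :1 :* :1 :+ :1 :* :- v) :* y₁ :+ :1 :* :1 :* y₀)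
        := :0 :+ :- :1 :* ((y₁ :- y₀) :- v :* (y₂ :- y₁)))
      refl c⁻ (F n) (F (suc n)) (F (2 ℕ.+ n)))

  g-value : eval g c⁻ ≈ Lz (b Z.- a) * (1# - P (Z.- a))
  g-value = begin
    eval g c⁻                                       ≈⟨ solve 3 (λ v y₀ y₁ →
      v :* y₀ :+ v :* (v :* y₁ :- (:1 :+ v) :* y₀ :+ v :* :0) := v :* v :* (y₁ :- y₀))
      refl c⁻ (x (+ 0)) (x (+ 1)) ⟩
    c⁻ * c⁻ * Δ (+ 0)                               ≈⟨ *-congˡ (Δ-closed (+ 0)) ⟩
    c⁻ * c⁻ * (Lz (a Z.* + 0 Z.+ b) * (P a - 1#))   ≡⟨ Eq.cong (λ i → c⁻ * c⁻ * (Lz i * (P a - 1#))) a*0+b≡b ⟩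
    c⁻ * c⁻ * (Lz b * (P a - 1#))                   ≈⟨ *-congˡ (*-congˡ (P-reflection a)) ⟩
    c⁻ * c⁻ * (Lz b * (c⁺ * d))                     ≈⟨ modulo (c⁻ * Lz b * d) (Lz-inverse a) (solve 4 (λ u v B d →
      v :* v :* (B :* (u :* d)) := B :* v :* d :+ v :* B :* d :* (u :* v :- :1))
      refl c⁺ c⁻ (Lz b) d) ⟩
    Lz b * c⁻ * d                                   ≈⟨ *-congʳ (sym (Lz-+ b (Z.- a))) ⟩
    Lz (b Z.- a) * d                                ∎
    where
    d = 1# - P (Z.- a)
    a*0+b≡b : a Z.* + 0 Z.+ b ≡ b
    a*0+b≡b = Eq.trans (Eq.cong (Z._+ b) (ℤP.*-zeroʳ a)) (ℤP.+-identityˡ b)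

  -- (2): F(t) = p(t) / q(t) with q(t) = (1 - t)(1 - L^a t) ...
  p q : Poly
  p = x (+ 0) ∷ x (+ 1) - (1# + c⁺) * x (+ 0) ∷ []
  q = - (1# + c⁺) ∷ c⁺ ∷ []

  p-numerator : ((1# ∷ q) ·ˢ F) ≈ˢ toSeries p
  p-numerator = quadratic-annihilates _ _ _ F _ _ recurrence (*-identityˡ _)
    (solve 3 (λ u y₀ y₁ → :1 :* y₁ :+ :- (:1 :+ u) :* y₀ := y₁ :- (:1 :+ u) :* y₀)
      refl c⁺ (F 0) (F 1))
    where
    recurrence : ∀ n → 1# * F (2 ℕ.+ n) + (- (1# + c⁺) * F (suc n) + c⁺ * F n) ≈ 0#
    recurrence n = modulo 1# (ratio (+ n)) (solve 4 (λ u y₀ y₁ y₂ →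
      :1 :* y₂ :+ (:- (:1 :+ u) :* y₁ :+ u :* y₀)
        := :0 :+ :1 :* ((y₂ :- y₁) :- u :* (y₁ :- y₀)))
      refl c⁺ (F n) (F (suc n)) (F (2 ℕ.+ n)))

  -- ... and T(u) = r(u) / s(u), u = t⁻¹, with s(u) = u² q(u⁻¹), r(u) = -u² p(u⁻¹).
  -- T = u T⁻ where T⁻ m = x (-(m+1)) satisfies the mirrored recurrence.
  T T⁻ : Series
  T = negSeries a b
  T⁻ m = x -[1+ m ]

  s r : Poly
  s = - (1# + c⁺) ∷ 1# ∷ []
  r = 0# ∷ - (x (+ 1) - (1# + c⁺) * x (+ 0)) ∷ - x (+ 0) ∷ []

  -- the recurrence at n = -1, -2 gives the two leading coefficients of r
  r-numerator : ((c⁺ ∷ s) ·ˢ T) ≈ˢ toSeries r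
  r-numerator = shift-rational (c⁺ ∷ s) T T⁻ _ T≈uT⁻ (quadratic-annihilates _ _ _ T⁻ _ _ recurrence
      (modulo 1# (ratio -[1+ 0 ]) (solve 4 (λ u y₋₁ y₀ y₁ →
        u :* y₋₁ := :- (y₁ :- (:1 :+ u) :* y₀) :+ :1 :* ((y₁ :- y₀) :- u :* (y₀ :- y₋₁)))
        refl c⁺ (x -[1+ 0 ]) (x (+ 0)) (x (+ 1))))
      (modulo 1# (ratio -[1+ 1 ]) (solve 4 (λ u y₋₂ y₋₁ y₀ →
        u :* y₋₂ :+ :- (:1 :+ u) :* y₋₁ := :- y₀ :+ :1 :* ((y₀ :- y₋₁) :- u :* (y₋₁ :- y₋₂)))
        refl c⁺ (x -[1+ 1 ]) (x -[1+ 0 ]) (x (+ 0)))))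
    where
    T≈uT⁻ : T ≈ˢ shift T⁻
    T≈uT⁻ zero = refl
    T≈uT⁻ (suc m) = refl
    recurrence : ∀ m → c⁺ * T⁻ (2 ℕ.+ m) + (- (1# + c⁺) * T⁻ (suc m) + 1# * T⁻ m) ≈ 0#
    recurrence m = modulo 1# (ratio -[1+ 2 ℕ.+ m ]) (solve 4 (λ u y₀ y₁ y₂ →
      u :* y₀ :+ (:- (:1 :+ u) :* y₁ :+ :1 :* y₂)
        := :0 :+ :1 :* ((y₂ :- y₁) :- u :* (y₁ :- y₀)))
      refl c⁺ (T⁻ (2 ℕ.+ m)) (T⁻ (suc m)) (T⁻ m))

  sum-vanishes : ∀ k → laurentCoeff p (c⁺ ∷ s) k + laurentCoeff (1# ∷ q) r k ≈ 0#
  sum-vanishes = reciprocal-sum-vanishes _ _ 1# (- (1# + c⁺)) c⁺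

lemma4p6 : ∀ {c ℓ} (R : CommutativeRing c ℓ) (L Linv : CommutativeRing.Carrier R)
    → CommutativeRing._≈_ R (CommutativeRing._*_ R L Linv) (CommutativeRing.1# R)
    → (a b : ℤ)
    → let open CommutativeRing R
          open Motivic R L Linv
          F = posSeries a b
          T = negSeries a b
          cₐ = Lz (Z.- a)
      in
      -- (1) g(t) = (t - 1)(t - L^(-a)) F(t) is a polynomial, with g(L^(-a)) = L^(b-a)(1 - [P^(-a)])
      (Σ Poly λ g →
          ((- 1# ∷ 1# ∷ []) ·ˢ ((- cₐ ∷ 1# ∷ []) ·ˢ F)) ≈ˢ toSeries g
        × eval g cₐ ≈ Lz (b Z.- a) * (1# - P (Z.- a)))
      ×
      -- (2) F(t) = p(t)/q(t) and T(u) = r(u)/s(u) (u = t⁻¹) are rational, with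
      --     q, s having invertible constant terms, and p(t)/q(t) + r(t⁻¹)/s(t⁻¹) = 0,
      --     i.e. p(t) s(t⁻¹) + q(t) r(t⁻¹) = 0 as Laurent polynomials.
      (Σ Poly λ p → Σ Carrier λ q₀ → Σ Poly λ q → Σ Poly λ r → Σ Carrier λ s₀ → Σ Poly λ s →
          (Σ Carrier λ v → q₀ * v ≈ 1#)
        × (Σ Carrier λ w → s₀ * w ≈ 1#)
        × ((q₀ ∷ q) ·ˢ F) ≈ˢ toSeries p
        × ((s₀ ∷ s) ·ˢ T) ≈ˢ toSeries r
        × (∀ (k : ℤ) → laurentCoeff p (s₀ ∷ s) k + laurentCoeff (q₀ ∷ q) r k ≈ 0#))
lemma4p6 R L Linv L*Linv≈1 a b =
  (g , g-numerator , g-value) ,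
  (p , 1# , q , r , c⁺ , s , (1# , *-identityˡ 1#) , (c⁻ , Lz-inverse a) , p-numerator , r-numerator , sum-vanishes)
  where
  open CommutativeRing R using (1#; *-identityˡ)
  open MotivicClasses R L Linv L*Linv≈1 using (Lz-inverse)
  open Progression R L Linv L*Linv≈1 a b
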